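{- The $q$-Schröder numbers $r_n(q)=\sum_{k=0}^n\binom{n+k}{n-k}C_kq^{n-k}$, $n\ge0$, where $C_k=\frac{1}{k+1}\binom{2k}{k}$ is the $k$-th Catalan number, form a $q$-log-convex sequence.
   Context: For real polynomials, $f(q)\le_q g(q)$ means $g-f$ has nonnegative coefficients; $\{P_n(q)\}_{n\ge0}$ is $q$-log-convex if $P_n(q)^2\le_q P_{n-1}(q)P_{n+1}(q)$ for all $n\ge1$. ($r_n(q)$ equals $\sum_P q^{\mathrm{diag}(P)}$ over lattice paths $P$ from $(0,0)$ to $(n,n)$ with steps $(1,0),(0,1),(1,1)$ never rising above $y=x$, $\mathrm{diag}(P)$ being the number of diagonal steps.) -}

module Defs where

open import Data.Nat using (ℕ; zero; suc; _+_; _*_; _∸_; _≤_; _<?_)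
open import Data.Nat.DivMod using (_/_)
open import Data.Nat.Combinatorics using (_C_)
open import Relation.Nullary.Decidable using (yes; no)

-- A polynomial with natural-number coefficients, given by its coefficient
-- sequence: Poly f means coefficient of q^i is f i (finitely many nonzero
-- for the polynomials considered below).
Poly : Set
Poly = ℕ → ℕ

sumTo : ℕ → (ℕ → ℕ) → ℕ
sumTo zero    f = f 0
sumTo (suc n) f = sumTo n f + f (suc n)

_·_ : Poly → Poly → Poly
(f · g) m = sumTo m (λ i → f i * g (m ∸ i))

infixl 7 _·_

_≤q_ : Poly → Poly → Set
f ≤q g = ∀ i → f i ≤ g i

catalan : ℕ → ℕ
catalan k = ((2 * k) C k) / suc k

-- Polynomial  Σ_{k=0}^{n} a(k) q^{n-k}  as a coefficient sequence:
-- coefficient of q^j is a(n-j) for j ≤ n, and 0 for j > n.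
revSum : ℕ → (ℕ → ℕ) → Poly
revSum n a j with n <? j
... | yes _ = 0
... | no  _ = a (n ∸ j)

schroderQ : ℕ → Poly
schroderQ n = revSum n (λ k → ((n + k) C (n ∸ k)) * catalan k)

QLogConvex : (ℕ → Poly) → Set
QLogConvex P = ∀ n → (P (suc n) · P (suc n)) ≤q (P n · P (suc (suc n)))

module Submission where

-- Let R e n be the sum of q^diag(P) over the lattice paths P with steps (1,0),
-- (0,1), (1,1) from (0, -e) to (n, n) never rising above y = x; so r_n = R 0 n.  Splitting off the first step gives
--   R e (n+1) = R (e-1) (n+1) + R (e+1) n + q R e n   (first term only for e > 0).
-- By induction on n, expanding one factor at a time by this recurrence, every
-- minor R d n R e (n+1) - R d (n+1) R e n with d ≤ e has nonnegative
-- coefficients; one more expansion turns the minor with d = 0, e = 1 into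
-- r_n r_(n+2) - r_(n+1)^2.  It remains to identify R 0 n with the closed form:
-- for n = b + j its coefficient of q^j is C(2b+j, j) times the ballot number
-- ballot 0 b = C_b, the j diagonal steps being placed freely among 2b+j steps.

open import Defs
open import Data.Nat
  using (ℕ; zero; suc; _+_; _*_; _∸_; _≤_; _<_; _≤′_; ≤′-refl; ≤′-step; z≤n; s≤s; _<?_; _≤?_)
open import Data.Nat.Properties
open import Data.Nat.Combinatorics using (_C_; nCk+nC[k+1]≡[n+1]C[k+1]; nCk≡nC[n∸k]; nCn≡1; nC1≡n; k>n⇒nCk≡0)
open import Data.Nat.DivMod using (_/_; m*n/n≡m)
open import Data.Nat.Tactic.RingSolver using (solve-∀)
open import Algebra.Properties.CommutativeSemigroup +-commutativeSemigroup using (interchange)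
open import Data.Empty using (⊥-elim)
open import Relation.Binary.PropositionalEquality
open import Relation.Nullary using (yes; no)
open ≡-Reasoning

sumTo-cong : ∀ n {f g : ℕ → ℕ} → (∀ i → i ≤ n → f i ≡ g i) → sumTo n f ≡ sumTo n g
sumTo-cong zero    f≡g = f≡g 0 z≤n
sumTo-cong (suc n) f≡g =
  cong₂ _+_ (sumTo-cong n (λ i i≤n → f≡g i (m≤n⇒m≤1+n i≤n))) (f≡g (suc n) ≤-refl)

sumTo-+ : ∀ n (f g : ℕ → ℕ) → sumTo n (λ i → f i + g i) ≡ sumTo n f + sumTo n g
sumTo-+ zero    f g = refl
sumTo-+ (suc n) f g =
  trans (cong (_+ (f (suc n) + g (suc n))) (sumTo-+ n f g))
        (interchange (sumTo n f) (sumTo n g) (f (suc n)) (g (suc n)))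

sumTo-mono : ∀ n {f g : ℕ → ℕ} → (∀ i → f i ≤ g i) → sumTo n f ≤ sumTo n g
sumTo-mono zero    f≤g = f≤g 0
sumTo-mono (suc n) f≤g = +-mono-≤ (sumTo-mono n f≤g) (f≤g (suc n))

sumTo-suc : ∀ n (f : ℕ → ℕ) → sumTo (suc n) f ≡ f 0 + sumTo n (λ i → f (suc i))
sumTo-suc zero    f = refl
sumTo-suc (suc n) f = trans (cong (_+ f (2 + n)) (sumTo-suc n f)) (+-assoc (f 0) _ _)

sumTo-reverse : ∀ n (f : ℕ → ℕ) → sumTo n f ≡ sumTo n (λ i → f (n ∸ i))
sumTo-reverse zero    f = refl
sumTo-reverse (suc n) f = begin
  sumTo n f + f (suc n)                        ≡⟨ cong (_+ f (suc n)) (sumTo-reverse n f) ⟩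
  sumTo n (λ i → f (n ∸ i)) + f (suc n)        ≡⟨ +-comm _ (f (suc n)) ⟩
  f (suc n) + sumTo n (λ i → f (n ∸ i))        ≡⟨ sumTo-suc n (λ i → f (suc n ∸ i)) ⟨
  sumTo (suc n) (λ i → f (suc n ∸ i))          ∎

infixr 6 _⊕_
_⊕_ : Poly → Poly → Poly
(f ⊕ g) i = f i + g i

infix 8 q·_
q·_ : Poly → Poly
(q· f) zero    = 0
(q· f) (suc i) = f i

one : Poly
one zero    = 1
one (suc _) = 0

·-cong : ∀ {f f′ g g′ : Poly} → f ≗ f′ → g ≗ g′ → f · g ≗ f′ · g′
·-cong f≗f′ g≗g′ m = sumTo-cong m (λ i _ → cong₂ _*_ (f≗f′ i) (g≗g′ (m ∸ i)))

·-comm : ∀ (f g : Poly) → f · g ≗ g · f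
·-comm f g m = trans (sumTo-reverse m _) (sumTo-cong m λ i i≤m →
  trans (cong (λ k → f (m ∸ i) * g k) (m∸[m∸n]≡n i≤m)) (*-comm (f (m ∸ i)) (g i)))

·-distribʳ-⊕ : ∀ (f g h : Poly) → (f ⊕ g) · h ≗ f · h ⊕ g · h
·-distribʳ-⊕ f g h m =
  trans (sumTo-cong m (λ i _ → *-distribʳ-+ (h (m ∸ i)) (f i) (g i))) (sumTo-+ m _ _)

q·-·ˡ : ∀ (f g : Poly) → (q· f) · g ≗ q· (f · g)
q·-·ˡ f g zero    = refl
q·-·ˡ f g (suc m) = sumTo-suc m _

≤q-resp-≗ : ∀ {f f′ g g′ : Poly} → f ≗ f′ → g ≗ g′ → f ≤q g → f′ ≤q g′
≤q-resp-≗ f≗f′ g≗g′ f≤g i = subst₂ _≤_ (f≗f′ i) (g≗g′ i) (f≤g i)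

≤q-mono-seq : ∀ (P : ℕ → Poly) → (∀ d → P d ≤q P (suc d)) → ∀ {d e} → d ≤′ e → P d ≤q P e
≤q-mono-seq P step ≤′-refl        i = ≤-refl
≤q-mono-seq P step (≤′-step d≤′e) i = ≤-trans (≤q-mono-seq P step d≤′e i) (step _ i)

-- Comparisons of products get their own relation, indexed by the four factors:
-- unifying a product f · g against another one would eta-expand it into its
-- coefficients and lose the factors, so none of them could be left implicit.
infix 4 _·_⊑_·_
record _·_⊑_·_ (a w a′ w′ : Poly) : Set where
  constructor ⊑-coeffwise
  field ≤q-products : (a · w) ≤q (a′ · w′)
open _·_⊑_·_

·-comm-⊑ : ∀ (a w : Poly) → a · w ⊑ w · a
·-comm-⊑ a w = ⊑-coeffwise (λ i → ≤-reflexive (·-comm a w i))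

⊑-trans : ∀ {a w b v c u : Poly} → a · w ⊑ b · v → b · v ⊑ c · u → a · w ⊑ c · u
⊑-trans (⊑-coeffwise ≤bv) (⊑-coeffwise ≤cu) = ⊑-coeffwise (λ i → ≤-trans (≤bv i) (≤cu i))

⊑-swap : ∀ {a w a′ w′ : Poly} → a · w ⊑ a′ · w′ → w · a ⊑ w′ · a′
⊑-swap {a} {w} {a′} {w′} (⊑-coeffwise ≤) = ⊑-coeffwise (≤q-resp-≗ (·-comm a w) (·-comm a′ w′) ≤)

·-monoˡ-⊑ : ∀ {f g : Poly} (h : Poly) → f ≤q g → f · h ⊑ g · h
·-monoˡ-⊑ h f≤g = ⊑-coeffwise (λ m → sumTo-mono m (λ i → *-monoˡ-≤ (h (m ∸ i)) (f≤g i)))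

module _ {a a′ w w′ : Poly} where

  ⊕-·-monoˡ : ∀ {b b′} → a · w ⊑ a′ · w′ → b · w ⊑ b′ · w′ → (a ⊕ b) · w ⊑ (a′ ⊕ b′) · w′
  ⊕-·-monoˡ {b} {b′} (⊑-coeffwise ≤a) (⊑-coeffwise ≤b) = ⊑-coeffwise
    (≤q-resp-≗ (λ i → sym (·-distribʳ-⊕ a b w i)) (λ i → sym (·-distribʳ-⊕ a′ b′ w′ i))
               (λ i → +-mono-≤ (≤a i) (≤b i)))

  q·-·-monoˡ : a · w ⊑ a′ · w′ → (q· a) · w ⊑ (q· a′) · w′
  q·-·-monoˡ (⊑-coeffwise ≤a) = ⊑-coeffwise
    (≤q-resp-≗ (λ i → sym (q·-·ˡ a w i)) (λ i → sym (q·-·ˡ a′ w′ i)) ≤q·)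
    where
    ≤q· : (q· (a · w)) ≤q (q· (a′ · w′))
    ≤q· zero    = z≤n
    ≤q· (suc i) = ≤a i

  ⊕-·-monoʳ : ∀ {b b′} → w · a ⊑ w′ · a′ → w · b ⊑ w′ · b′ → w · (a ⊕ b) ⊑ w′ · (a′ ⊕ b′)
  ⊕-·-monoʳ ≤a ≤b = ⊑-swap (⊕-·-monoˡ (⊑-swap ≤a) (⊑-swap ≤b))

  q·-·-monoʳ : w · a ⊑ w′ · a′ → w · (q· a) ⊑ w′ · (q· a′)
  q·-·-monoʳ ≤a = ⊑-swap (q·-·-monoˡ (⊑-swap ≤a))

QLogConvex-resp : ∀ {P Q : ℕ → Poly} → (∀ n → P n ≗ Q n) → QLogConvex P → QLogConvex Q
QLogConvex-resp P≗Q convex n =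
  ≤q-resp-≗ (·-cong (P≗Q (suc n)) (P≗Q (suc n))) (·-cong (P≗Q n) (P≗Q (2 + n))) (convex n)

pascal : ∀ n k → n C k + n C suc k ≡ suc n C suc k
pascal = nCk+nC[k+1]≡[n+1]C[k+1]

-- The index equations let callers pass the upper indices in whatever form the
-- recurrence for R produces them.
pascal-* : ∀ {N N′ N″} j B → N′ ≡ N → N″ ≡ suc N →
  (N C suc j) * B + (N′ C j) * B ≡ (N″ C suc j) * B
pascal-* {N} j B refl refl = begin
  (N C suc j) * B + (N C j) * B   ≡⟨ *-distribʳ-+ B (N C suc j) (N C j) ⟨
  (N C suc j + N C j) * B         ≡⟨ cong (_* B) (trans (+-comm (N C suc j) (N C j)) (pascal N j)) ⟩
  (suc N C suc j) * B             ∎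

pascal-*₂ : ∀ {N N′ N″ N‴} j B₁ B₂ → N′ ≡ N → N″ ≡ N → N‴ ≡ suc N →
  (N C suc j) * B₁ + ((N′ C suc j) * B₂ + (N″ C j) * (B₁ + B₂)) ≡ (N‴ C suc j) * (B₁ + B₂)
pascal-*₂ {N} j B₁ B₂ refl refl refl =
  trans (regroup (N C suc j) (N C j) B₁ B₂) (cong (_* (B₁ + B₂)) (pascal N j))
  where
  regroup : ∀ X Y B₁ B₂ → X * B₁ + (X * B₂ + Y * (B₁ + B₂)) ≡ (Y + X) * (B₁ + B₂)
  regroup = solve-∀

C-symmetric : ∀ a b → (a + b) C a ≡ (a + b) C b
C-symmetric a b = trans (nCk≡nC[n∸k] (m≤m+n a b)) (cong ((a + b) C_) (m+n∸m≡n a b))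

C-absorption : ∀ n k → suc k * (suc n C suc k) ≡ suc n * (n C k)
C-absorption zero    zero    = refl
C-absorption zero    (suc k) =
  trans (cong ((2 + k) *_) (k>n⇒nCk≡0 {1} {2 + k} (s≤s (s≤s z≤n))))
        (trans (*-zeroʳ (2 + k)) (sym (cong (1 *_) (k>n⇒nCk≡0 {0} {suc k} (s≤s z≤n)))))
C-absorption (suc n) zero    = trans (*-identityˡ _) (trans (nC1≡n (2 + n)) (sym (*-identityʳ _)))
C-absorption (suc n) (suc k) = begin
  (2 + k) * ((2 + n) C (2 + k))                ≡⟨ cong ((2 + k) *_) (pascal (suc n) (suc k)) ⟨
  (2 + k) * (X + Y)                            ≡⟨ expand k X Y ⟩
  X + suc k * X + (2 + k) * Y                  ≡⟨ cong₂ (λ u v → X + u + v) (C-absorption n k) (C-absorption n (suc k)) ⟩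
  X + suc n * (n C k) + suc n * (n C suc k)    ≡⟨ collect n X (n C k) (n C suc k) ⟩
  X + suc n * (n C k + n C suc k)              ≡⟨ cong (λ u → X + suc n * u) (pascal n k) ⟩
  X + suc n * X                                ∎
  where
  X = suc n C suc k
  Y = suc n C (2 + k)
  expand : ∀ k X Y → (2 + k) * (X + Y) ≡ X + suc k * X + (2 + k) * Y
  expand = solve-∀
  collect : ∀ n X P Q → X + suc n * P + suc n * Q ≡ X + suc n * (P + Q)
  collect = solve-∀

C-ratio : ∀ k m → suc k * ((k + suc m) C suc k) ≡ suc m * ((k + suc m) C k)
C-ratio k m = begin
  suc k * ((k + suc m) C suc k)      ≡⟨ cong (λ n → suc k * (n C suc k)) (+-suc k m) ⟩
  suc k * (suc (k + m) C suc k)      ≡⟨ C-absorption (k + m) k ⟩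
  suc (k + m) * ((k + m) C k)        ≡⟨ cong (suc (k + m) *_) (C-symmetric k m) ⟩
  suc (k + m) * ((k + m) C m)        ≡⟨ C-absorption (k + m) m ⟨
  suc m * (suc (k + m) C suc m)      ≡⟨ cong (λ n → suc m * (n C suc m)) (+-suc k m) ⟨
  suc m * ((k + suc m) C suc m)      ≡⟨ cong (suc m *_) (C-symmetric k (suc m)) ⟨
  suc m * ((k + suc m) C k)          ∎

R : ℕ → ℕ → Poly
R e       zero    = one
R zero    (suc n) = R 1 n ⊕ q· R 0 n
R (suc e) (suc n) = R e (suc n) ⊕ R (2 + e) n ⊕ q· R (suc e) n

MinorsNonneg : ℕ → Set
MinorsNonneg n = ∀ d e → d ≤ e → R d (suc n) · R e n ⊑ R d n · R e (suc n)

minorsNonneg-zero : MinorsNonneg 0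
minorsNonneg-zero d e d≤e =
  ⊑-trans (·-monoˡ-⊑ one (R-1-mono (≤⇒≤′ d≤e))) (·-comm-⊑ (R e 1) one)
  where
  R-1-mono : ∀ {d e} → d ≤′ e → R d 1 ≤q R e 1
  R-1-mono = ≤q-mono-seq (λ d → R d 1) (λ d i → m≤m+n _ _)

module _ {n} (minors : MinorsNonneg n) where

  upper-minor : ∀ {d e} → d < e →
    (R (suc d) (suc n) ⊕ q· R d (suc n)) · R e n ⊑ (R (suc d) n ⊕ q· R d n) · R e (suc n)
  upper-minor {d} {e} d<e = ⊕-·-monoˡ (minors (suc d) e d<e) (q·-·-monoˡ (minors d e (<⇒≤ d<e)))

  lopsided-minor : ∀ d {e} → d < e → R d (2 + n) · R e n ⊑ R d (suc n) · R e (suc n)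
  lopsided-minor zero    d<e = upper-minor d<e
  lopsided-minor (suc d) d<e = ⊕-·-monoˡ (lopsided-minor d (<-trans (n<1+n d) d<e)) (upper-minor d<e)

  minorsNonneg-suc : MinorsNonneg (suc n)
  minorsNonneg-suc d e d≤e = expand-right (≤⇒≤′ d≤e)
    where
    expand-right : ∀ {e} → d ≤′ e → R d (2 + n) · R e (suc n) ⊑ R d (suc n) · R e (2 + n)
    expand-right ≤′-refl = ·-comm-⊑ (R d (2 + n)) (R d (suc n))
    expand-right (≤′-step d≤′e) =
      ⊕-·-monoʳ (expand-right d≤′e)
        (⊕-·-monoʳ (lopsided-minor d (s≤s (m≤n⇒m≤1+n (≤′⇒≤ d≤′e))))
                   (q·-·-monoʳ (lopsided-minor d (s≤s (≤′⇒≤ d≤′e)))))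

minorsNonneg : ∀ n → MinorsNonneg n
minorsNonneg zero    = minorsNonneg-zero
minorsNonneg (suc n) = minorsNonneg-suc (minorsNonneg n)

R₀-qLogConvex : QLogConvex (R 0)
R₀-qLogConvex n = ≤q-products
  (⊕-·-monoʳ (minorsNonneg n 0 1 z≤n) (q·-·-monoʳ (·-comm-⊑ (R 0 (suc n)) (R 0 n))))

ballot : ℕ → ℕ → ℕ
ballot d       zero    = 1
ballot zero    (suc b) = ballot 1 b
ballot (suc d) (suc b) = ballot d (suc b) + ballot (2 + d) b

ballot-pascal : ∀ d b → ballot d (suc b) + (2 + (d + (b + b))) C b ≡ (2 + (d + (b + b))) C suc b
ballot-pascal zero    zero    = refl
ballot-pascal zero    (suc c) = begin
  x + N C suc c                  ≡⟨ cong (λ n → x + n C suc c) N≡1+M ⟩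
  x + suc M C suc c              ≡⟨ cong (x +_) (pascal M c) ⟨
  x + (M C c + M C suc c)        ≡⟨ +-assoc x _ _ ⟨
  (x + M C c) + M C suc c        ≡⟨ cong (_+ M C suc c) (ballot-pascal 1 c) ⟩
  M C suc c + M C suc c          ≡⟨ cong (M C suc c +_) symmetric ⟩
  M C suc c + M C (2 + c)        ≡⟨ pascal M (suc c) ⟩
  suc M C (2 + c)                ≡⟨ cong (_C (2 + c)) N≡1+M ⟨
  N C (2 + c)                    ∎
  where
  x = ballot 1 (suc c)
  N = 2 + (suc c + suc c)
  M = 3 + (c + c)
  N≡1+M : N ≡ suc M
  N≡1+M = cong (3 +_) (+-suc c c)
  symmetric : M C suc c ≡ M C (2 + c)
  symmetric = subst (λ n → n C suc c ≡ n C (2 + c))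
                    (cong suc (trans (+-suc c (suc c)) (cong suc (+-suc c c))))
                    (C-symmetric (suc c) (2 + c))
ballot-pascal (suc d) zero    =
  trans (cong (_+ 1) (trans (ballot-pascal d 0) (nC1≡n (2 + (d + 0)))))
        (trans (+-comm (2 + (d + 0)) 1) (sym (nC1≡n (3 + (d + 0)))))
ballot-pascal (suc d) (suc c) = begin
  (x + y) + suc M C suc c          ≡⟨ cong ((x + y) +_) (pascal M c) ⟨
  (x + y) + (M C c + M C suc c)    ≡⟨ regroup x y (M C c) (M C suc c) ⟩
  (y + M C c) + (x + M C suc c)    ≡⟨ cong₂ _+_ (trans (cong (λ n → y + n C c) M≡) (ballot-pascal (2 + d) c))
                                                (ballot-pascal d (suc c)) ⟩
  M′ C suc c + M C (2 + c)         ≡⟨ cong (λ n → n C suc c + M C (2 + c)) M≡ ⟨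
  M C suc c + M C (2 + c)          ≡⟨ pascal M (suc c) ⟩
  suc M C (2 + c)                  ∎
  where
  x = ballot d (2 + c)
  y = ballot (2 + d) (suc c)
  M = 2 + (d + (suc c + suc c))
  M′ = 2 + (2 + d + (c + c))
  index : ∀ d c → 2 + (d + (suc c + suc c)) ≡ 2 + (2 + d + (c + c))
  index = solve-∀
  M≡ : M ≡ M′
  M≡ = index d c
  regroup : ∀ x y P Q → (x + y) + (P + Q) ≡ (y + P) + (x + Q)
  regroup = solve-∀

ballot₀-catalan : ∀ b → ballot 0 b * suc b ≡ (2 * b) C b
ballot₀-catalan zero    = refl
ballot₀-catalan (suc c) =
  trans (+-cancelʳ-≡ ((2 + c) * (N C c)) _ _ scaled) (cong (_C suc c) (double c))
  where
  N = 2 + (c + c)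
  double : ∀ c → 2 + (c + c) ≡ 2 * suc c
  double = solve-∀
  ratio : suc c * (N C suc c) ≡ (2 + c) * (N C c)
  ratio = subst (λ n → suc c * (n C suc c) ≡ (2 + c) * (n C c))
                (trans (+-suc c (suc c)) (cong suc (+-suc c c))) (C-ratio c (suc c))
  scaled : ballot 1 c * (2 + c) + (2 + c) * (N C c) ≡ N C suc c + (2 + c) * (N C c)
  scaled = begin
    ballot 1 c * (2 + c) + (2 + c) * (N C c)   ≡⟨ factor (ballot 1 c) (N C c) c ⟩
    (ballot 1 c + N C c) * (2 + c)             ≡⟨ cong (_* (2 + c)) (ballot-pascal 0 c) ⟩
    (N C suc c) * (2 + c)                      ≡⟨ *-comm (N C suc c) (2 + c) ⟩
    N C suc c + suc c * (N C suc c)            ≡⟨ cong (N C suc c +_) ratio ⟩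
    N C suc c + (2 + c) * (N C c)              ∎
    where
    factor : ∀ x y c → x * (2 + c) + (2 + c) * y ≡ (x + y) * (2 + c)
    factor = solve-∀

catalan≡ballot₀ : ∀ b → catalan b ≡ ballot 0 b
catalan≡ballot₀ b = trans (cong (_/ suc b) (sym (ballot₀-catalan b))) (m*n/n≡m (ballot 0 b) (suc b))

R-vanishes : ∀ d {n j} → n < j → R d n j ≡ 0
R-vanishes d       {zero}  {suc j} n<j       = refl
R-vanishes zero    {suc n} {suc j} (s≤s n<j) =
  cong₂ _+_ (R-vanishes 1 (m<n⇒m<1+n n<j)) (R-vanishes 0 n<j)
R-vanishes (suc d) {suc n} {suc j} (s≤s n<j) =
  cong₂ _+_ (R-vanishes d (s≤s n<j))
            (cong₂ _+_ (R-vanishes (2 + d) (m<n⇒m<1+n n<j)) (R-vanishes (suc d) n<j))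

R-constant : ∀ d b → R d b 0 ≡ ballot d b
R-constant d       zero    = refl
R-constant zero    (suc b) = trans (+-identityʳ _) (R-constant 1 b)
R-constant (suc d) (suc b) =
  cong₂ _+_ (R-constant d (suc b)) (trans (+-identityʳ _) (R-constant (2 + d) b))

R-leading : ∀ d j → R d j j ≡ (d + j) C j
R-leading d       zero    = refl
R-leading zero    (suc j) = begin
  R 1 j (suc j) + R 0 j j   ≡⟨ cong₂ _+_ (R-vanishes 1 (n<1+n j)) (R-leading 0 j) ⟩
  j C j                     ≡⟨ nCn≡1 j ⟩
  1                         ≡⟨ nCn≡1 (suc j) ⟨
  suc j C suc j             ∎
R-leading (suc d) (suc j) = begin
  R d (suc j) (suc j) + (R (2 + d) j (suc j) + R (suc d) j j)
    ≡⟨ cong₂ _+_ (R-leading d (suc j)) (cong₂ _+_ (R-vanishes (2 + d) (n<1+n j)) (R-leading (suc d) j)) ⟩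
  (d + suc j) C suc j + suc (d + j) C j
    ≡⟨ cong (λ n → (d + suc j) C suc j + n C j) (+-suc d j) ⟨
  (d + suc j) C suc j + (d + suc j) C j
    ≡⟨ +-comm _ ((d + suc j) C j) ⟩
  (d + suc j) C j + (d + suc j) C suc j
    ≡⟨ pascal (d + suc j) j ⟩
  suc (d + suc j) C suc j
    ∎

R-coeff : ∀ d b j → R d (b + j) j ≡ ((b + b + d + j) C j) * ballot d b
R-coeff d       b       zero    =
  trans (cong (λ n → R d n 0) (+-identityʳ b)) (trans (R-constant d b) (sym (*-identityˡ (ballot d b))))
R-coeff d       zero    (suc j) = trans (R-leading d (suc j)) (sym (*-identityʳ _))
R-coeff zero    (suc b) (suc j) =
  trans (cong₂ _+_ (R-coeff 1 b (suc j))
                   (trans (cong (λ n → R 0 n j) (+-suc b j)) (R-coeff 0 (suc b) j)))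
        (pascal-* j (ballot 1 b) (index₁ b j) (index₂ b j))
  where
  index₁ : ∀ b j → suc b + suc b + 0 + j ≡ b + b + 1 + suc j
  index₁ = solve-∀
  index₂ : ∀ b j → suc b + suc b + 0 + suc j ≡ suc (b + b + 1 + suc j)
  index₂ = solve-∀
R-coeff (suc d) (suc b) (suc j) =
  trans (cong₂ _+_ (R-coeff d (suc b) (suc j))
                   (cong₂ _+_ (R-coeff (2 + d) b (suc j))
                              (trans (cong (λ n → R (suc d) n j) (+-suc b j)) (R-coeff (suc d) (suc b) j))))
        (pascal-*₂ j (ballot d (suc b)) (ballot (2 + d) b) (index₁ b d j) (index₂ b d j) (index₃ b d j))
  where
  index₁ : ∀ b d j → b + b + (2 + d) + suc j ≡ suc b + suc b + d + suc j
  index₁ = solve-∀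
  index₂ : ∀ b d j → suc b + suc b + suc d + j ≡ suc b + suc b + d + suc j
  index₂ = solve-∀
  index₃ : ∀ b d j → suc b + suc b + suc d + suc j ≡ suc (suc b + suc b + d + suc j)
  index₃ = solve-∀

revSum-≤ : ∀ {n j} a → j ≤ n → revSum n a j ≡ a (n ∸ j)
revSum-≤ {n} {j} a j≤n with n <? j
... | yes n<j = ⊥-elim (<⇒≱ n<j j≤n)
... | no  _   = refl

revSum-> : ∀ {n j} a → n < j → revSum n a j ≡ 0
revSum-> {n} {j} a n<j with n <? j
... | yes _   = refl
... | no  n≮j = ⊥-elim (n≮j n<j)

schroderQ-coeff : ∀ {n} b j → b + j ≡ n → ((n + b) C (n ∸ b)) * catalan b ≡ R 0 n j
schroderQ-coeff b j refl = begin
  ((b + j + b) C (b + j ∸ b)) * catalan b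
    ≡⟨ cong₂ _*_ (cong₂ _C_ (index b j) (m+n∸m≡n b j)) (catalan≡ballot₀ b) ⟩
  ((b + b + 0 + j) C j) * ballot 0 b
    ≡⟨ R-coeff 0 b j ⟨
  R 0 (b + j) j
    ∎
  where
  index : ∀ b j → b + j + b ≡ b + b + 0 + j
  index = solve-∀

schroderQ≗R₀ : ∀ n → schroderQ n ≗ R 0 n
schroderQ≗R₀ n j with j ≤? n
... | yes j≤n = trans (revSum-≤ _ j≤n) (schroderQ-coeff (n ∸ j) j (m∸n+n≡m j≤n))
... | no  j≰n = trans (revSum-> _ (≰⇒> j≰n)) (sym (R-vanishes 0 (≰⇒> j≰n)))

corollary4p10 : QLogConvex schroderQ
corollary4p10 = QLogConvex-resp (λ n j → sym (schroderQ≗R₀ n j)) R₀-qLogConvex
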